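{- If $G$ is a unicyclic graph of order $n$, then $n-1\leq\alpha(G)+\mu(G)\leq n$.
   Context: All graphs are finite, simple and undirected. A graph is unicyclic if it is connected and contains exactly one cycle. $\alpha(G)$ is the maximum cardinality of an independent set (a set of pairwise non-adjacent vertices) of $G$, and $\mu(G)$ is the maximum cardinality of a matching of $G$. -}

module Defs where

open import Data.Nat using (ℕ; _≤_; suc)
open import Data.Fin using (Fin)
open import Data.Fin.Subset using (Subset; _∈_; ∣_∣)
open import Data.List using (List; []; _∷_; _++_; length; concatMap)
open import Data.List.Relation.Unary.All using (All)
open import Data.List.Relation.Unary.Unique.Propositional using (Unique)
open import Data.Product using (Σ; ∃; _×_; _,_)
open import Data.Sum using (_⊎_)
open import Data.Empty using (⊥)
open import Relation.Nullary using (¬_)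
open import Function.Bundles using (_⇔_)
open import Relation.Binary.PropositionalEquality using (_≡_)

record Graph (n : ℕ) : Set₁ where
  field
    Adj   : Fin n → Fin n → Set
    irrefl : ∀ v → ¬ Adj v v
    sym    : ∀ {u v} → Adj u v → Adj v u
open Graph public

module _ {n : ℕ} (G : Graph n) where

  data Walk : Fin n → Fin n → Set where
    nil  : ∀ {v} → Walk v v
    cons : ∀ {u w v} → Adj G u w → Walk w v → Walk u v

  Connected : Set
  Connected = ∀ u v → Walk u v

  data Chain : List (Fin n) → Set where
    c[]  : Chain []
    c[-] : ∀ {v} → Chain (v ∷ [])
    c∷   : ∀ {u v vs} → Adj G u v → Chain (v ∷ vs) → Chain (u ∷ v ∷ vs)

  -- A cycle, given as a list of k ≥ 3 distinct vertices v₀ v₁ … v_{k-1}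
  -- with v_i ~ v_{i+1} and v_{k-1} ~ v₀.  (Closing edge stated via
  -- the chain of  vs ++ [v₀].)
  record Cycle : Set where
    constructor mkCycle
    field
      v₀    : Fin n
      rest  : List (Fin n)
      long  : 2 ≤ length rest
      distinct : Unique (v₀ ∷ rest)
      chain : Chain (v₀ ∷ rest ++ (v₀ ∷ []))
  open Cycle public

data Consec {n : ℕ} (u v : Fin n) : List (Fin n) → Set where
  here  : ∀ {vs} → Consec u v (u ∷ v ∷ vs)
  there : ∀ {w vs} → Consec u v vs → Consec u v (w ∷ vs)

module _ {n : ℕ} {G : Graph n} where
  CycleEdge : Cycle G → Fin n → Fin n → Set
  CycleEdge C u v =
    Consec u v (v₀ C ∷ rest C ++ (v₀ C ∷ [])) ⊎ Consec v u (v₀ C ∷ rest C ++ (v₀ C ∷ []))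

  -- two cycle representations describe the same cycle (subgraph) iff they
  -- have the same edge set
  SameCycle : Cycle G → Cycle G → Set
  SameCycle C D = ∀ u v → CycleEdge C u v ⇔ CycleEdge D u v

module _ {n : ℕ} (G : Graph n) where

  Unicyclic : Set
  Unicyclic = Connected G × Σ (Cycle G) (λ C → ∀ (D : Cycle G) → SameCycle D C)

  Independent : Subset n → Set
  Independent S = ∀ u v → u ∈ S → v ∈ S → ¬ Adj G u v

  IsIndependenceNumber : ℕ → Set
  IsIndependenceNumber a =
    Σ (Subset n) (λ S → Independent S × ∣ S ∣ ≡ a) × (∀ S → Independent S → ∣ S ∣ ≤ a)

  endpoints : List (Fin n × Fin n) → List (Fin n)
  endpoints = concatMap (λ { (u , v) → u ∷ v ∷ [] })

  Matching : List (Fin n × Fin n) → Set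
  Matching M = All (λ { (u , v) → Adj G u v }) M × Unique (endpoints M)

  IsMatchingNumber : ℕ → Set
  IsMatchingNumber m =
    Σ (List (Fin n × Fin n)) (λ M → Matching M × length M ≡ m) × (∀ M → Matching M → length M ≤ m)

module Submission where

-- Upper bound (any graph): every edge of a matching has an endpoint outside a
-- given independent set S; picking one such endpoint per edge yields |M|
-- distinct vertices outside S, hence |S| + |M| ≤ n.
--
-- Lower bound: delete one edge {x,y} of the cycle.  The resulting graph G'
-- has no cycle, since a cycle of G' is a cycle of G, hence the unique one,
-- hence uses {x,y}.  An acyclic graph has a "packing": an independent set S
-- and a matching M with n ≤ |S| + |M|.  It is built by repeatedly removing a
-- vertex v of degree ≤ 1 in the remaining vertex set R (putting v into S, and
-- matching it to its neighbour if it has one); such a v exists because if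
-- every vertex of R has two neighbours in R, walking along them closes a
-- cycle.  Dropping x from S makes it independent in G, so n - 1 ≤ a + m.
--
-- The lower-bound construction inspects adjacency, which is not decidable
-- in general; since the goal is a decidable inequality, it suffices to
-- derive it from the (doubly negated) decidability of adjacency.

open import Defs
open import Data.Nat using (ℕ; zero; suc; _+_; _∸_; _≤_; _<_; z≤n; s≤s; _≤?_)
open import Data.Nat.Properties
  using (≤-refl; ≤-trans; ≤-reflexive; ≤-pred; m≤n⇒m≤1+n; +-suc; +-identityʳ; +-mono-≤; ∸-monoˡ-≤; <⇒≱; m<m+n; module ≤-Reasoning)
open import Data.Product using (_×_; _,_; Σ; ∃; proj₁; proj₂)
open import Data.Sum using (_⊎_; inj₁; inj₂; [_,_])
open import Data.Fin using (Fin; zero; suc; _≟_)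
open import Data.Fin.Properties using (any?)
open import Data.Fin.Subset using (Subset; _∈_; _∉_; _⊆_; ∣_∣; _∪_; _-_; ⁅_⁆; ⊤; inside; outside; Empty)
  renaming (⊥ to ∅)
open import Data.Fin.Subset.Properties
  using (_∈?_; nonempty?; Empty-unique; ∣p∣≤n; ∣⊥∣≡0; ∣⊤∣≡n; ∉⊥; x∈⁅y⁆⇒x≡y; x∈p∪q⁻;
         ∪-identityʳ; p─⊥≡p; p─q⊆p; ∣p─q∣≤∣p∣; x∈p⇒∣p-x∣<∣p∣)
open import Data.Vec using (_∷_; here; there)
open import Data.List using (List; []; _∷_; _++_; length)
open import Data.List.Relation.Unary.All as All using (All; []; _∷_)
open import Data.List.Relation.Unary.AllPairs using ([]; _∷_)
open import Data.List.Relation.Unary.Unique.Propositional using (Unique)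
open import Data.List.Relation.Unary.Any using (here; there)
open import Data.List.Membership.Propositional using () renaming (_∈_ to _∈ₗ_)
open import Function using (_∘_)
open import Function.Bundles using (Equivalence)
open import Relation.Nullary using (¬_; Dec; yes; no; _×-dec_; _⊎-dec_; ¬?; contradiction; decidable-stable; ¬¬-map; ¬¬-excluded-middle)
open import Relation.Binary.PropositionalEquality using (_≡_; _≢_; refl; cong; subst; subst₂; ≢-sym)
  renaming (sym to ≡-sym)

search : ∀ {n} {P Q : Fin n → Set} → (∀ i → P i ⊎ Q i) → ∃ P ⊎ (∀ i → Q i)
search {zero} dichotomy = inj₂ λ ()
search {suc n} dichotomy with dichotomy zero | search (dichotomy ∘ suc)
... | inj₁ p | _            = inj₁ (zero , p)
... | inj₂ q | inj₁ (i , p) = inj₁ (suc i , p)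
... | inj₂ q | inj₂ qs      = inj₂ λ { zero → q ; (suc i) → qs i }

¬¬-∀Fin : ∀ {n} {P : Fin n → Set} → (∀ i → ¬ ¬ P i) → ¬ ¬ (∀ i → P i)
¬¬-∀Fin {zero} _ k = k λ ()
¬¬-∀Fin {suc n} {P} h k =
  h zero λ p₀ → ¬¬-∀Fin {P = P ∘ suc} (h ∘ suc) λ ps → k λ { zero → p₀ ; (suc i) → ps i }

∣p∪⁅x⁆∣≡1+∣p∣ : ∀ {n} (p : Subset n) x → x ∉ p → ∣ p ∪ ⁅ x ⁆ ∣ ≡ suc ∣ p ∣
∣p∪⁅x⁆∣≡1+∣p∣ (outside ∷ p) zero    x∉p = cong (suc ∘ ∣_∣) (∪-identityʳ p)
∣p∪⁅x⁆∣≡1+∣p∣ (inside ∷ p)  zero    x∉p = contradiction here x∉p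
∣p∪⁅x⁆∣≡1+∣p∣ (outside ∷ p) (suc x) x∉p = ∣p∪⁅x⁆∣≡1+∣p∣ p x (x∉p ∘ there)
∣p∪⁅x⁆∣≡1+∣p∣ (inside ∷ p)  (suc x) x∉p = cong suc (∣p∪⁅x⁆∣≡1+∣p∣ p x (x∉p ∘ there))

∣p∣≤1+∣p-x∣ : ∀ {n} (p : Subset n) x → ∣ p ∣ ≤ suc ∣ p - x ∣
∣p∣≤1+∣p-x∣ (inside ∷ p)  zero    = s≤s (≤-reflexive (cong ∣_∣ (≡-sym (p─⊥≡p p))))
∣p∣≤1+∣p-x∣ (outside ∷ p) zero    = m≤n⇒m≤1+n (≤-reflexive (cong ∣_∣ (≡-sym (p─⊥≡p p))))
∣p∣≤1+∣p-x∣ (inside ∷ p)  (suc x) = s≤s (∣p∣≤1+∣p-x∣ p x)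
∣p∣≤1+∣p-x∣ (outside ∷ p) (suc x) = ∣p∣≤1+∣p-x∣ p x

x∉p-x : ∀ {n} (p : Subset n) x → x ∉ p - x
x∉p-x (_ ∷ p) zero    ()
x∉p-x (_ ∷ p) (suc x) (there x∈p-x) = x∉p-x p x x∈p-x

∈p-x⇒∈p : ∀ {n} {p : Subset n} {x z} → z ∈ p - x → z ∈ p
∈p-x⇒∈p {p = p} {x} = p─q⊆p p ⁅ x ⁆

∈p-x⇒≢ : ∀ {n} {p : Subset n} {x z} → z ∈ p - x → z ≢ x
∈p-x⇒≢ {p = p} z∈p-x refl = x∉p-x p _ z∈p-x

∈p∪⁅x⁆⇒ : ∀ {n} {p : Subset n} {x z} → z ∈ p ∪ ⁅ x ⁆ → z ∈ p ⊎ z ≡ x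
∈p∪⁅x⁆⇒ {p = p} {x} z∈ with x∈p∪q⁻ p ⁅ x ⁆ z∈
... | inj₁ z∈p  = inj₁ z∈p
... | inj₂ z∈⁅x⁆ = inj₂ (x∈⁅y⁆⇒x≡y x z∈⁅x⁆)

∣p∣+length≤n : ∀ {n} (p : Subset n) (xs : List (Fin n)) → Unique xs → All (_∉ p) xs → ∣ p ∣ + length xs ≤ n
∣p∣+length≤n p []       _                 _          = ≤-trans (≤-reflexive (+-identityʳ ∣ p ∣)) (∣p∣≤n p)
∣p∣+length≤n {n} p (x ∷ xs) (x≢xs ∷ xs-unique) (x∉p ∷ xs∉p) = begin
  ∣ p ∣ + suc (length xs)    ≡⟨ +-suc ∣ p ∣ (length xs) ⟩
  suc ∣ p ∣ + length xs      ≡⟨ cong (_+ length xs) (∣p∪⁅x⁆∣≡1+∣p∣ p x x∉p) ⟨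
  ∣ p ∪ ⁅ x ⁆ ∣ + length xs  ≤⟨ ∣p∣+length≤n (p ∪ ⁅ x ⁆) xs xs-unique (All.zipWith avoid (x≢xs , xs∉p)) ⟩
  n                          ∎
  where
  open ≤-Reasoning
  avoid : ∀ {z} → x ≢ z × z ∉ p → z ∉ p ∪ ⁅ x ⁆
  avoid (x≢z , z∉p) z∈ with ∈p∪⁅x⁆⇒ z∈
  ... | inj₁ z∈p = z∉p z∈p
  ... | inj₂ z≡x = x≢z (≡-sym z≡x)

length≤n : ∀ {n} (xs : List (Fin n)) → Unique xs → length xs ≤ n
length≤n {n} xs xs-unique =
  subst (λ k → k + length xs ≤ n) (∣⊥∣≡0 n) (∣p∣+length≤n ∅ xs xs-unique (All.universal (λ _ → ∉⊥) xs))

-- Upper bound: α(G) + μ(G) ≤ n for every graph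

module _ {n} (G : Graph n) where

  outsideEndpoints : (S : Subset n) → Independent G S → (M : List (Fin n × Fin n)) → Matching G M →
                     Σ (List (Fin n)) λ T → Unique T × All (_∉ S) T × length T ≡ length M ×
                                             (∀ {z} → z ∈ₗ T → z ∈ₗ endpoints G M)
  outsideEndpoints S S-ind [] _ = [] , [] , [] , refl , λ ()
  outsideEndpoints S S-ind ((u , v) ∷ M) (u~v ∷ M-adj , (u≢ ∷ (v≢ ∷ M-unique)))
    with outsideEndpoints S S-ind M (M-adj , M-unique) | u ∈? S
  ... | T , T-unique , T∉S , ∣T∣ , T⊆ | yes u∈S =
    v ∷ T , All.tabulate (All.lookup v≢ ∘ T⊆) ∷ T-unique , (λ v∈S → S-ind u v u∈S v∈S u~v) ∷ T∉S ,
    cong suc ∣T∣ , λ { (here refl) → there (here refl) ; (there z∈T) → there (there (T⊆ z∈T)) }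
  ... | T , T-unique , T∉S , ∣T∣ , T⊆ | no u∉S =
    u ∷ T , All.tabulate (All.lookup (All.tail u≢) ∘ T⊆) ∷ T-unique , u∉S ∷ T∉S ,
    cong suc ∣T∣ , λ { (here refl) → here refl ; (there z∈T) → there (there (T⊆ z∈T)) }

  ∣S∣+∣M∣≤n : ∀ {S M} → Independent G S → Matching G M → ∣ S ∣ + length M ≤ n
  ∣S∣+∣M∣≤n {S} {M} S-ind M-mat with outsideEndpoints S S-ind M M-mat
  ... | T , T-unique , T∉S , ∣T∣≡∣M∣ , _ = subst (λ k → ∣ S ∣ + k ≤ n) ∣T∣≡∣M∣ (∣p∣+length≤n S T T-unique T∉S)

prefixTo : ∀ {A : Set} {w : A} {xs} → w ∈ₗ xs → List A
prefixTo {xs = z ∷ _} (here _)  = z ∷ []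
prefixTo {xs = z ∷ _} (there m) = z ∷ prefixTo m

1≤length-prefixTo : ∀ {A : Set} {w : A} {xs} (m : w ∈ₗ xs) → 1 ≤ length (prefixTo m)
1≤length-prefixTo {xs = _ ∷ _} (here _)  = s≤s z≤n
1≤length-prefixTo {xs = _ ∷ _} (there _) = s≤s z≤n

All-prefixTo : ∀ {A : Set} {P : A → Set} {w xs} (m : w ∈ₗ xs) → All P xs → All P (prefixTo m)
All-prefixTo (here _)  (p ∷ _)  = p ∷ []
All-prefixTo (there m) (p ∷ ps) = p ∷ All-prefixTo m ps

Unique-prefixTo : ∀ {A : Set} {w : A} {xs} (m : w ∈ₗ xs) → Unique xs → Unique (prefixTo m)
Unique-prefixTo (here _)  (_ ∷ _)          = [] ∷ []
Unique-prefixTo (there m) (z≢ ∷ xs-unique) = All-prefixTo m z≢ ∷ Unique-prefixTo m xs-unique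

module _ {n} {H : Graph n} where

  Chain-prefixTo : ∀ {y w c ys} → Chain H (y ∷ ys) → (m : w ∈ₗ ys) → Adj H w c → Chain H (y ∷ prefixTo m ++ c ∷ [])
  Chain-prefixTo (c∷ y~w _) (here refl) w~c = c∷ y~w (c∷ w~c c[-])
  Chain-prefixTo (c∷ y~z path) (there m) w~c = c∷ y~z (Chain-prefixTo path m w~c)

  closeCycle : ∀ {c p rest w} → Unique (c ∷ p ∷ rest) → Chain H (c ∷ p ∷ rest) → w ∈ₗ rest → Adj H c w → Cycle H
  closeCycle {c} {p} ((c≢p ∷ c≢rest) ∷ (p≢rest ∷ rest-unique)) (c∷ c~p path) w∈rest c~w =
    mkCycle c (p ∷ prefixTo w∈rest) (s≤s (1≤length-prefixTo w∈rest))
      ((c≢p ∷ All-prefixTo w∈rest c≢rest) ∷ (All-prefixTo w∈rest p≢rest ∷ Unique-prefixTo w∈rest rest-unique))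
      (c∷ c~p (Chain-prefixTo path w∈rest (sym H c~w)))

-- Acyclic graphs with decidable adjacency have α + μ ≥ n

module Acyclic {n} (H : Graph n) (adj? : ∀ u v → Dec (Adj H u v)) (acyclic : ¬ Cycle H) where

  open import Data.List.Membership.DecPropositional (_≟_ {n}) using () renaming (_∈?_ to _∈ₗ?_)

  data LowDegree (R : Subset n) (v : Fin n) : Set where
    isolated : (∀ w → w ∈ R → ¬ Adj H v w) → LowDegree R v
    pendant  : ∀ u → u ∈ R → Adj H v u → (∀ w → w ∈ R → Adj H v w → w ≡ u) → LowDegree R v

  TwoNeighbours : Subset n → Fin n → Set
  TwoNeighbours R v = Σ (Fin n) λ w → Σ (Fin n) λ w' → (w ∈ R × Adj H v w) × (w' ∈ R × Adj H v w') × w ≢ w'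

  lowDegree? : ∀ R v → LowDegree R v ⊎ TwoNeighbours R v
  lowDegree? R v with any? (λ w → w ∈? R ×-dec adj? v w)
  ... | no none = inj₁ (isolated λ w w∈R v~w → none (w , w∈R , v~w))
  ... | yes (u , u∈R , v~u) with any? (λ w → (w ∈? R ×-dec adj? v w) ×-dec ¬? (w ≟ u))
  ...   | yes (w , w-nb , w≢u) = inj₂ (u , w , (u∈R , v~u) , w-nb , ≢-sym w≢u)
  ...   | no none = inj₁ (pendant u u∈R v~u λ w w∈R v~w →
                      decidable-stable (w ≟ u) λ w≢u → none (w , (w∈R , v~w) , w≢u))

  -- If every vertex of a nonempty R has two neighbours in R, there is a cycle:
  -- a simple path in R can always be extended or closed.
  module _ (R : Subset n) (branching : ∀ v → v ∈ R → TwoNeighbours R v) where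

    neighbourAvoiding : ∀ v → v ∈ R → (p : Fin n) → Σ (Fin n) λ w → w ∈ R × Adj H v w × w ≢ p
    neighbourAvoiding v v∈R p with branching v v∈R
    ... | w , w' , (w∈R , v~w) , (w'∈R , v~w') , w≢w' with w ≟ p
    ...   | yes refl = w' , w'∈R , v~w' , ≢-sym w≢w'
    ...   | no w≢p   = w , w∈R , v~w , w≢p

    -- The fuel f bounds the number of extensions: simple paths have ≤ n vertices.
    extendPath : (f : ℕ) (c p : Fin n) (rest : List (Fin n)) → c ∈ R →
                 Unique (c ∷ p ∷ rest) → Chain H (c ∷ p ∷ rest) → n < f + length (c ∷ p ∷ rest) → Cycle H
    extendPath zero c p rest _ path-unique _ n<len = contradiction (length≤n _ path-unique) (<⇒≱ n<len)
    extendPath (suc f) c p rest c∈R path-unique path n<len with neighbourAvoiding c c∈R p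
    ... | w , w∈R , c~w , w≢p with w ∈ₗ? (p ∷ rest)
    ...   | yes (here w≡p)     = contradiction w≡p w≢p
    ...   | yes (there w∈rest) = closeCycle path-unique path w∈rest c~w
    ...   | no w∉path =
      extendPath f w c (p ∷ rest) w∈R
        (All.tabulate (λ { (here refl) w≡c → irrefl H c (subst (Adj H c) w≡c c~w)
                         ; (there z∈) w≡z → w∉path (subst (_∈ₗ _) (≡-sym w≡z) z∈) }) ∷ path-unique)
        (c∷ (sym H c~w) path)
        (subst (n <_) (≡-sym (+-suc f _)) n<len)

    branching⇒cycle : ∀ z → z ∈ R → Cycle H
    branching⇒cycle z z∈R with neighbourAvoiding z z∈R z
    ... | w , w∈R , z~w , w≢z =
      extendPath n w z [] w∈R ((w≢z ∷ []) ∷ ([] ∷ [])) (c∷ (sym H z~w) c[-]) (m<m+n n (s≤s z≤n))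

  record Packing (R : Subset n) : Set where
    field
      S           : Subset n
      M           : List (Fin n × Fin n)
      S⊆R         : S ⊆ R
      M⊆R         : All (_∈ R) (endpoints H M)
      independent : Independent H S
      matching    : Matching H M
      large       : ∣ R ∣ ≤ ∣ S ∣ + length M

  emptyPacking : ∀ R → Empty R → Packing R
  emptyPacking R empty = record
    { S = ∅ ; M = [] ; S⊆R = λ z∈∅ → contradiction z∈∅ ∉⊥ ; M⊆R = [] ; independent = λ _ _ u∈∅ → contradiction u∈∅ ∉⊥
    ; matching = [] , [] ; large = ≤-trans (≤-reflexive ∣R∣≡0) z≤n }
    where
    ∣R∣≡0 : ∣ R ∣ ≡ 0
    ∣R∣≡0 = subst (λ p → ∣ p ∣ ≡ 0) (≡-sym (Empty-unique empty)) (∣⊥∣≡0 n)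

  independent-∪⁅x⁆ : ∀ {S x} → Independent H S → (∀ s → s ∈ S → ¬ Adj H x s) → Independent H (S ∪ ⁅ x ⁆)
  independent-∪⁅x⁆ {S} {x} S-ind x≁S u v u∈ v∈ with ∈p∪⁅x⁆⇒ u∈ | ∈p∪⁅x⁆⇒ v∈
  ... | inj₁ u∈S  | inj₁ v∈S  = S-ind u v u∈S v∈S
  ... | inj₁ u∈S  | inj₂ refl = x≁S u u∈S ∘ sym H
  ... | inj₂ refl | inj₁ v∈S  = x≁S v v∈S
  ... | inj₂ refl | inj₂ refl = irrefl H u

  extendIsolated : ∀ {R v} → v ∈ R → (∀ w → w ∈ R → ¬ Adj H v w) → Packing (R - v) → Packing R
  extendIsolated {R} {v} v∈R v-isolated P = record
    { S = S ∪ ⁅ v ⁆ ; M = M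
    ; S⊆R = λ z∈ → [ ∈p-x⇒∈p ∘ S⊆R , (λ { refl → v∈R }) ] (∈p∪⁅x⁆⇒ z∈)
    ; M⊆R = All.map ∈p-x⇒∈p M⊆R
    ; independent = independent-∪⁅x⁆ independent λ s s∈S → v-isolated s (∈p-x⇒∈p (S⊆R s∈S))
    ; matching = matching
    ; large = begin
        ∣ R ∣                    ≤⟨ ∣p∣≤1+∣p-x∣ R v ⟩
        suc ∣ R - v ∣            ≤⟨ s≤s large ⟩
        suc ∣ S ∣ + length M     ≡⟨ cong (_+ length M) (∣p∪⁅x⁆∣≡1+∣p∣ S v λ v∈S → ∈p-x⇒≢ (S⊆R v∈S) refl) ⟨
        ∣ S ∪ ⁅ v ⁆ ∣ + length M ∎ }
    where
    open Packing P
    open ≤-Reasoning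

  extendPendant : ∀ {R v u} → v ∈ R → u ∈ R → Adj H v u → (∀ w → w ∈ R → Adj H v w → w ≡ u) →
                  Packing (R - v - u) → Packing R
  extendPendant {R} {v} {u} v∈R u∈R v~u only-u P = record
    { S = S ∪ ⁅ v ⁆ ; M = (v , u) ∷ M
    ; S⊆R = λ z∈ → [ ∈R ∘ S⊆R , (λ { refl → v∈R }) ] (∈p∪⁅x⁆⇒ z∈)
    ; M⊆R = v∈R ∷ u∈R ∷ All.map ∈R M⊆R
    ; independent = independent-∪⁅x⁆ independent λ s s∈S v~s →
        ∈p-x⇒≢ (S⊆R s∈S) (only-u s (∈R (S⊆R s∈S)) v~s)
    ; matching = v~u ∷ proj₁ matching ,  -- the endpoints of M lie in R - v - u
        (v≢u ∷ All.map (λ z∈ → ≢-sym (∈p-x⇒≢ (∈p-x⇒∈p z∈))) M⊆R) ∷ (All.map (≢-sym ∘ ∈p-x⇒≢) M⊆R ∷ proj₂ matching)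
    ; large = begin
        ∣ R ∣                            ≤⟨ ∣p∣≤1+∣p-x∣ R v ⟩
        suc ∣ R - v ∣                    ≤⟨ s≤s (∣p∣≤1+∣p-x∣ (R - v) u) ⟩
        suc (suc ∣ R - v - u ∣)          ≤⟨ s≤s (s≤s large) ⟩
        suc (suc (∣ S ∣ + length M))     ≡⟨ cong suc (+-suc ∣ S ∣ (length M)) ⟨
        suc ∣ S ∣ + suc (length M)       ≡⟨ cong (_+ suc (length M)) (∣p∪⁅x⁆∣≡1+∣p∣ S v v∉S) ⟨
        ∣ S ∪ ⁅ v ⁆ ∣ + suc (length M)   ∎ }
    where
    open Packing P
    open ≤-Reasoning
    ∈R : ∀ {z} → z ∈ R - v - u → z ∈ R
    ∈R = ∈p-x⇒∈p ∘ ∈p-x⇒∈p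
    v≢u : v ≢ u
    v≢u refl = irrefl H v v~u
    v∉S : v ∉ S
    v∉S v∈S = ∈p-x⇒≢ (∈p-x⇒∈p (S⊆R v∈S)) refl

  classify : ∀ R v → (v ∈ R × LowDegree R v) ⊎ (v ∈ R → TwoNeighbours R v)
  classify R v with v ∈? R
  ... | no v∉R = inj₂ λ v∈R → contradiction v∈R v∉R
  ... | yes v∈R with lowDegree? R v
  ...   | inj₁ low = inj₁ (v∈R , low)
  ...   | inj₂ two = inj₂ λ _ → two

  ∣R-v∣≤f : ∀ {R : Subset n} {v f} → v ∈ R → ∣ R ∣ ≤ suc f → ∣ R - v ∣ ≤ f
  ∣R-v∣≤f v∈R ∣R∣≤1+f = ≤-pred (≤-trans (x∈p⇒∣p-x∣<∣p∣ v∈R) ∣R∣≤1+f)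

  pack : ∀ f R → ∣ R ∣ ≤ f → Packing R
  pack f R ∣R∣≤f with nonempty? R
  ... | no empty = emptyPacking R empty
  ... | yes (z , z∈R) with f | search (classify R)
  ...   | zero  | _ = contradiction (≤-trans (x∈p⇒∣p-x∣<∣p∣ z∈R) ∣R∣≤f) λ ()
  ...   | suc f | inj₂ branching = contradiction (branching⇒cycle R branching z z∈R) acyclic
  ...   | suc f | inj₁ (v , v∈R , isolated v-isolated) =
    extendIsolated v∈R v-isolated (pack f (R - v) (∣R-v∣≤f v∈R ∣R∣≤f))
  ...   | suc f | inj₁ (v , v∈R , pendant u u∈R v~u only-u) =
    extendPendant v∈R u∈R v~u only-u (pack f (R - v - u) (≤-trans (∣p─q∣≤∣p∣ (R - v) ⁅ u ⁆) (∣R-v∣≤f v∈R ∣R∣≤f)))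

  n≤∣S∣+∣M∣ : Σ (Subset n) λ S → Σ (List (Fin n × Fin n)) λ M → Independent H S × Matching H M × n ≤ ∣ S ∣ + length M
  n≤∣S∣+∣M∣ = S , M , independent , matching , subst (_≤ ∣ S ∣ + length M) (∣⊤∣≡n n) large
    where open Packing (pack n ⊤ (≤-reflexive (∣⊤∣≡n n)))

_⊑_ : ∀ {n} → Graph n → Graph n → Set
H ⊑ G = ∀ {u v} → Adj H u v → Adj G u v

Chain-⊑ : ∀ {n} {H G : Graph n} → H ⊑ G → ∀ {L} → Chain H L → Chain G L
Chain-⊑ H⊑G c[]          = c[]
Chain-⊑ H⊑G c[-]         = c[-]
Chain-⊑ H⊑G (c∷ u~v path) = c∷ (H⊑G u~v) (Chain-⊑ H⊑G path)

Matching-⊑ : ∀ {n} {H G : Graph n} → H ⊑ G → ∀ {M} → Matching H M → Matching G M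
Matching-⊑ {H = H} {G} H⊑G {[]}          ([] , M-unique) = [] , M-unique
Matching-⊑ {H = H} {G} H⊑G {(u , v) ∷ M} (u~v ∷ M-adj , M-unique@(_ ∷ _ ∷ tail-unique)) =
  H⊑G u~v ∷ proj₁ (Matching-⊑ {H = H} {G} H⊑G {M} (M-adj , tail-unique)) , M-unique

Consec-adj : ∀ {n} {H : Graph n} {u v L} → Chain H L → Consec u v L → Adj H u v
Consec-adj (c∷ u~v _)  here           = u~v
Consec-adj (c∷ _ path) (there consec) = Consec-adj path consec
Consec-adj c[-]        (there ())

module _ {n} (G : Graph n) (x y : Fin n) where

  IsXY : Fin n → Fin n → Set
  IsXY u v = (u ≡ x × v ≡ y) ⊎ (u ≡ y × v ≡ x)

  IsXY-sym : ∀ {u v} → IsXY u v → IsXY v u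
  IsXY-sym (inj₁ (u≡x , v≡y)) = inj₂ (v≡y , u≡x)
  IsXY-sym (inj₂ (u≡y , v≡x)) = inj₁ (v≡x , u≡y)

  deleteEdge : Graph n
  deleteEdge = record
    { Adj    = λ u v → Adj G u v × ¬ IsXY u v
    ; irrefl = λ v → irrefl G v ∘ proj₁
    ; sym    = λ (u~v , ¬xy) → sym G u~v , ¬xy ∘ IsXY-sym
    }

  deleteEdge-adj? : (∀ u v → Dec (Adj G u v)) → ∀ u v → Dec (Adj deleteEdge u v)
  deleteEdge-adj? adj? u v = adj? u v ×-dec ¬? ((u ≟ x ×-dec v ≟ y) ⊎-dec (u ≟ y ×-dec v ≟ x))

  -- If {x,y} lies on the only cycle of G, deleting it leaves no cycle: a cycle
  -- of the smaller graph is a cycle of G, hence contains {x,y}.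
  deleteEdge-acyclic : (C : Cycle G) → (∀ D → SameCycle D C) → CycleEdge C x y → ¬ Cycle deleteEdge
  deleteEdge-acyclic C unique xy∈C D with Equivalence.from (unique D-in-G x y) xy∈C
    where
    D-in-G : Cycle G
    D-in-G = mkCycle (v₀ D) (rest D) (long D) (distinct D) (Chain-⊑ proj₁ (chain D))
  ... | inj₁ xy-consec = proj₂ (Consec-adj (chain D) xy-consec) (inj₁ (refl , refl))
  ... | inj₂ yx-consec = proj₂ (Consec-adj (chain D) yx-consec) (inj₂ (refl , refl))

  independent-without-x : ∀ {S} → Independent deleteEdge S → Independent G (S - x)
  independent-without-x S-ind u v u∈ v∈ u~v = S-ind u v (∈p-x⇒∈p u∈) (∈p-x⇒∈p v∈) (u~v , λ
    { (inj₁ (u≡x , _)) → ∈p-x⇒≢ u∈ u≡x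
    ; (inj₂ (_ , v≡x)) → ∈p-x⇒≢ v∈ v≡x })

  n∸1≤∣S∣+∣M∣ : (∀ u v → Dec (Adj G u v)) → (C : Cycle G) → (∀ D → SameCycle D C) → CycleEdge C x y →
                Σ (Subset n) λ S → Σ (List (Fin n × Fin n)) λ M →
                  Independent G S × Matching G M × n ∸ 1 ≤ ∣ S ∣ + length M
  n∸1≤∣S∣+∣M∣ adj? C unique xy∈C
    with Acyclic.n≤∣S∣+∣M∣ deleteEdge (deleteEdge-adj? adj?) (deleteEdge-acyclic C unique xy∈C)
  ... | S , M , S-ind , M-mat , n≤∣S∣+∣M∣ =
    S - x , M , independent-without-x S-ind , Matching-⊑ {H = deleteEdge} {G} proj₁ M-mat ,
    ∸-monoˡ-≤ 1 (≤-trans n≤∣S∣+∣M∣ (+-mono-≤ (∣p∣≤1+∣p-x∣ S x) (≤-refl {length M})))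

¬¬-decidable : ∀ {n} (G : Graph n) → ¬ ¬ (∀ u v → Dec (Adj G u v))
¬¬-decidable G = ¬¬-∀Fin λ u → ¬¬-∀Fin λ v → ¬¬-excluded-middle

lemma2p3 : ∀ (n : ℕ) (G : Graph n) → Unicyclic G →
           ∀ (a m : ℕ) → IsIndependenceNumber G a → IsMatchingNumber G m →
           (n ∸ 1 ≤ a + m) × (a + m ≤ n)
lemma2p3 n G (_ , C@(mkCycle x (y ∷ _) _ _ _) , unique) a m ((S , S-ind , ∣S∣≡a) , α-max) ((M , M-mat , ∣M∣≡m) , μ-max) =
  lower , upper
  where
  upper : a + m ≤ n
  upper = subst₂ (λ i j → i + j ≤ n) ∣S∣≡a ∣M∣≡m (∣S∣+∣M∣≤n G S-ind M-mat)

  -- x and y are consecutive on C, so {x,y} is an edge of the cycle.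
  lowerFrom : (∀ u v → Dec (Adj G u v)) → n ∸ 1 ≤ a + m
  lowerFrom adj? with n∸1≤∣S∣+∣M∣ G x y adj? C unique (inj₁ here)
  ... | S' , M' , S'-ind , M'-mat , bound = ≤-trans bound (+-mono-≤ (α-max S' S'-ind) (μ-max M' M'-mat))

  lower : n ∸ 1 ≤ a + m
  lower = decidable-stable (n ∸ 1 ≤? a + m) (¬¬-map lowerFrom (¬¬-decidable G))
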